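{- For $0 < \varepsilon < 1/2$ and $0 < c < 2^{ -10}\varepsilon$, there exist $C = C(c,\varepsilon)$ and $n_0 = n_0(c,\varepsilon)$ such that the following holds for every $n \geq n_0$ and every $m$ with $(\log n)^2 \leq m \leq n/C$. If $G$ is a graph on $n$ vertices with $\delta(G) \geq (1/2 + \varepsilon)n$, then there exists a path $A\subset G$ with $v(A)\leq Cm$ such that for every set $U\subset V(G)\setminus V(A)$ with $|U|\leq cm$, there is a path $A_{U}\subset G$ which has the same endpoints as $A$ and vertex set $V(A_U) = V(A) \cup U$.
   Context: $\delta(G)$ is the minimum degree of $G$; $v(A)$ is the number of vertices of $A$. -}

module Defs where

open import Data.Nat using (ℕ; zero; suc; _+_; _*_; _∸_; _^_; _≤_; _!)
open import Data.Nat.Combinatorics using (_P_)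
open import Data.Fin using (Fin)
open import Data.Bool using (Bool; true; false; if_then_else_)
open import Data.Nat.ListAction using (sum)
open import Data.List using (List; []; _∷_; map; upTo; length; head; last)
open import Data.List.Relation.Unary.Unique.Propositional using (Unique)
open import Data.List.Relation.Unary.Linked using (Linked)
open import Data.Vec using (tabulate)
open import Data.Fin.Subset using (Subset; inside; outside; ∣_∣)
open import Data.Product using (Σ; ∃; _×_)
open import Relation.Binary.PropositionalEquality using (_≡_; _≢_)

record Graph (n : ℕ) : Set where
  field
    adj     : Fin n → Fin n → Bool
    adj-sym : ∀ u v → adj u v ≡ adj v u
    adj-irr : ∀ v → adj v v ≡ false

open Graph public

Adj : {n : ℕ} → Graph n → Fin n → Fin n → Set
Adj G u v = adj G u v ≡ true

nbhd : {n : ℕ} → Graph n → Fin n → Subset n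
nbhd G v = tabulate (λ w → if adj G v w then inside else outside)

deg : {n : ℕ} → Graph n → Fin n → ℕ
deg G v = ∣ nbhd G v ∣

-- Its vertex set is the set of list elements; v(A) = length of the list;
-- its endpoints are the first and last vertex of the list.

IsPath : {n : ℕ} → Graph n → List (Fin n) → Set
IsPath G xs = (xs ≢ []) × Unique xs × Linked (Adj G) xs

-- two paths have the same endpoints (a path may be traversed either way,
-- so we ask for equal first vertices and equal last vertices)
SameEndpoints : {n : ℕ} → List (Fin n) → List (Fin n) → Set
SameEndpoints xs ys = (head xs ≡ head ys) × (last xs ≡ last ys)

-- The condition (log n)^2 ≤ m, with log the natural logarithm,
-- expressed exactly in natural-number arithmetic.
--
-- (ln n)^2 ≤ m  ⇔  n ≤ e^{√m}.  For K = 2L+1 the Taylor partial sum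
--   S_K(√m) = Σ_{j ≤ K} (√m)^j / j!  equals  (P + √m · Q) / K!  with
--   P = Σ_{i ≤ L} m^i · K!/(2i)!,   Q = Σ_{i ≤ L} m^i · K!/(2i+1)!.
-- These partial sums increase to e^{√m}, and e^{√m} = n is only possible
-- for m = 0, n = 1 (Lindemann), where S_K = 1 = n. Hence
--   n ≤ e^{√m}  ⇔  ∃ L. n·K! ≤ P + √m·Q  ⇔  ∃ L. (n·K! ∸ P)^2 ≤ m·Q^2.
-- Here K!/j! = K P (K ∸ j) (falling factorial), exact for j ≤ K.

module _ (m L : ℕ) where
  private
    K : ℕ
    K = 2 * L + 1
  taylorEven : ℕ
  taylorEven = sum (map (λ i → m ^ i * (K P (K ∸ 2 * i))) (upTo (suc L)))
  taylorOdd : ℕ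
  taylorOdd = sum (map (λ i → m ^ i * (K P (K ∸ (2 * i + 1)))) (upTo (suc L)))

LogSqLe : ℕ → ℕ → Set
LogSqLe n m = ∃ λ L →
  (n * ((2 * L + 1) !) ∸ taylorEven m L) ^ 2 ≤ m * taylorOdd m L ^ 2

{-# OPTIONS --safe #-}
-- The absorbing path is grown greedily, three fresh vertices at a time: a
-- segment a ─ b ─ c in which ab is an edge and c joins b to the previous start
-- of the path. The segment absorbs every vertex u adjacent to both a and b,
-- since a ─ u ─ b may replace the edge ab. If δ(G) ≥ (1/2 + 1/R) n, any two
-- vertices have at least n/R common neighbours off a path with at most n/R
-- vertices, so double counting finds a fresh edge ab that absorbs a 1/R²
-- share of any weighting of the vertices. Let d_v be the number of absorbers v
-- still lacks to have m of them. The potential Φ = Σ_v (2^d_v − 1) loses at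
-- least half of v's term when v gains an absorber, so the step taken with the
-- weights 2^(d_v − 1) shrinks Φ by a factor 1 − 1/(2R²). As (log n)² ≤ m gives
-- n ≤ 2^(10m), Φ starts below 2^(11m) and vanishes after 2R²(11m + 1) steps;
-- then every vertex has m absorbers, and a set of at most m vertices off the
-- path is absorbed one vertex at a time, each into a still free absorber.
module Submission where

open import Defs

module Counting where
  open import Data.Nat
  open import Data.Nat.Properties
  open import Data.Nat.Tactic.RingSolver using (solve-∀)
  open import Data.Bool using (Bool; true; false; _∧_; _∨_; not)
  open import Data.Fin using (Fin; zero; suc)
  open import Data.Fin.Properties using () renaming (_≟_ to _≟ᶠ_)
  open import Data.List using (List; []; _∷_; length)
  open import Data.List.Membership.Propositional using (_∉_)
  open import Data.Product using (∃; _×_; _,_)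
  open import Function using (_∘_)
  open import Relation.Binary.PropositionalEquality using (_≡_; refl; sym; trans; cong; subst₂)
  open import Relation.Nullary using (yes; no; does)
  open import Algebra.Properties.Semiring.Sum +-*-semiring
    using (sum; sum-syntax; sum-cong-≗; ∑-comm; ∑-distrib-+; *-distribˡ-sum; *-distribʳ-sum)

  ∑-mono-≤ : ∀ {k} {f g : Fin k → ℕ} → (∀ i → f i ≤ g i) → sum f ≤ sum g
  ∑-mono-≤ {zero} f≤g = z≤n
  ∑-mono-≤ {suc k} f≤g = +-mono-≤ (f≤g zero) (∑-mono-≤ (λ i → f≤g (suc i)))

  ∑-const : ∀ k c → ∑[ i < k ] c ≡ k * c
  ∑-const zero c = refl
  ∑-const (suc k) c = cong (c +_) (∑-const k c)

  term≤∑ : ∀ {k} (f : Fin k → ℕ) i → f i ≤ sum f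
  term≤∑ f zero = m≤m+n (f zero) _
  term≤∑ f (suc i) = ≤-trans (term≤∑ (f ∘ suc) i) (m≤n+m _ (f zero))

  ∑-pick : ∀ {k} (f g : Fin k → ℕ) → sum f < sum g → ∃ λ i → f i < g i
  ∑-pick {zero} f g ()
  ∑-pick {suc k} f g ∑f<∑g with f zero <? g zero
  ... | yes f₀<g₀ = zero , f₀<g₀
  ... | no f₀≮g₀ with ∑-pick (f ∘ suc) (g ∘ suc) ∑tailf<∑tailg
    where
    ∑tailf<∑tailg : sum (f ∘ suc) < sum (g ∘ suc)
    ∑tailf<∑tailg = +-cancelˡ-< (f zero) _ _
      (<-≤-trans ∑f<∑g (+-monoˡ-≤ (sum (g ∘ suc)) (≮⇒≥ f₀≮g₀)))
  ...   | i , fi<gi = suc i , fi<gi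

  [_] : Bool → ℕ
  [ true ] = 1
  [ false ] = 0

  []≤1 : ∀ b → [ b ] ≤ 1
  []≤1 true = ≤-refl
  []≤1 false = z≤n

  [∧]≡[]*[] : ∀ a b → [ a ∧ b ] ≡ [ a ] * [ b ]
  [∧]≡[]*[] true b = sym (+-identityʳ [ b ])
  [∧]≡[]*[] false b = refl

  ∧-true : ∀ {a b} → a ∧ b ≡ true → a ≡ true × b ≡ true
  ∧-true {true} {true} refl = refl , refl

  count : ∀ {k} → (Fin k → Bool) → ℕ
  count p = ∑[ i < _ ] [ p i ]

  count-cong : ∀ {k} {p q : Fin k → Bool} → (∀ i → p i ≡ q i) → count p ≡ count q
  count-cong p≗q = sum-cong-≗ (cong [_] ∘ p≗q)

  count≤size : ∀ {k} (p : Fin k → Bool) → count p ≤ k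
  count≤size {k} p = ≤-trans (∑-mono-≤ ([]≤1 ∘ p)) (≤-reflexive (trans (∑-const k 1) (*-identityʳ k)))

  count-witness : ∀ {k} (p : Fin k → Bool) → 0 < count p → ∃ λ i → p i ≡ true
  count-witness {suc k} p 0<count with p zero in p₀
  ... | true = zero , p₀
  ... | false = let i , pi = count-witness (p ∘ suc) 0<count in suc i , pi

  count+count≤count∧+size : ∀ {k} (p q : Fin k → Bool) →
    count p + count q ≤ count (λ i → p i ∧ q i) + k
  count+count≤count∧+size {k} p q = begin
    count p + count q                        ≡⟨ ∑-distrib-+ ([_] ∘ p) ([_] ∘ q) ⟨
    ∑[ i < k ] ([ p i ] + [ q i ])           ≤⟨ ∑-mono-≤ (λ i → pointwise (p i) (q i)) ⟩
    ∑[ i < k ] ([ p i ∧ q i ] + 1)           ≡⟨ ∑-distrib-+ (λ i → [ p i ∧ q i ]) (λ _ → 1) ⟩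
    count (λ i → p i ∧ q i) + ∑[ i < k ] 1   ≡⟨ cong (count (λ i → p i ∧ q i) +_) (∑-const k 1) ⟩
    count (λ i → p i ∧ q i) + k * 1          ≡⟨ cong (count (λ i → p i ∧ q i) +_) (*-identityʳ k) ⟩
    count (λ i → p i ∧ q i) + k              ∎
    where
    open ≤-Reasoning
    pointwise : ∀ a b → [ a ] + [ b ] ≤ [ a ∧ b ] + 1
    pointwise true b = ≤-reflexive (+-comm 1 [ b ])
    pointwise false b = []≤1 b

  count∧≤count : ∀ {k} (p q : Fin k → Bool) → count (λ i → p i ∧ q i) ≤ count p
  count∧≤count p q = ∑-mono-≤ (λ i → pointwise (p i) (q i))
    where
    pointwise : ∀ a b → [ a ∧ b ] ≤ [ a ]
    pointwise true b = []≤1 b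
    pointwise false b = z≤n

  ∃-above-average : ∀ {k} (a : Fin k → Bool) (Y : Fin k → ℕ) X → 0 < count a →
    count a * X ≤ ∑[ i < k ] ([ a i ] * Y i) → ∃ λ i → a i ≡ true × X ≤ Y i
  ∃-above-average {k} a Y X 0<count total
    with ∑-pick (λ i → [ a i ] * X) (λ i → [ a i ] * suc (Y i)) ∑f<∑g
    where
    open ≤-Reasoning
    ∑f<∑g : ∑[ i < k ] ([ a i ] * X) < ∑[ i < k ] ([ a i ] * suc (Y i))
    ∑f<∑g = begin-strict
      ∑[ i < k ] ([ a i ] * X)                   ≡⟨ *-distribʳ-sum X ([_] ∘ a) ⟨
      count a * X                                ≤⟨ total ⟩
      ∑[ i < k ] ([ a i ] * Y i)                 <⟨ m<m+n _ 0<count ⟩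
      ∑[ i < k ] ([ a i ] * Y i) + count a       ≡⟨ ∑-distrib-+ (λ i → [ a i ] * Y i) ([_] ∘ a) ⟨
      ∑[ i < k ] ([ a i ] * Y i + [ a i ])       ≡⟨ sum-cong-≗ (λ i → trans (+-comm _ [ a i ]) (sym (*-suc [ a i ] (Y i)))) ⟩
      ∑[ i < k ] ([ a i ] * suc (Y i))           ∎
  ... | i , lt = i , selected (a i) lt
    where
    selected : ∀ b → [ b ] * X < [ b ] * suc (Y i) → b ≡ true × X ≤ Y i
    selected true lt = refl , ≤-pred (subst₂ _<_ (*-identityˡ X) (*-identityˡ (suc (Y i))) lt)

  double-counting : ∀ {k l} (a : Fin k → Bool) (b : Fin l → Fin k → Bool) (μ : Fin l → ℕ) R →
    0 < count a → (∀ v → k ≤ R * count (λ i → a i ∧ b v i)) →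
    ∃ λ i → a i ≡ true × ∑[ v < l ] μ v ≤ R * ∑[ v < l ] ([ b v i ] * μ v)
  double-counting {k} {l} a b μ R 0<count seen =
    ∃-above-average a (λ i → R * ∑[ v < l ] ([ b v i ] * μ v)) (sum μ) 0<count total
    where
    open ≤-Reasoning
    total : count a * sum μ ≤ ∑[ i < k ] ([ a i ] * (R * ∑[ v < l ] ([ b v i ] * μ v)))
    total = begin
      count a * sum μ                                       ≤⟨ *-monoˡ-≤ (sum μ) (count≤size a) ⟩
      k * sum μ                                             ≡⟨ *-distribˡ-sum k μ ⟩
      ∑[ v < l ] (k * μ v)                                  ≤⟨ ∑-mono-≤ (λ v → *-monoˡ-≤ (μ v) (seen v)) ⟩
      ∑[ v < l ] (R * count (λ i → a i ∧ b v i) * μ v)      ≡⟨ sum-cong-≗ expand ⟩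
      ∑[ v < l ] ∑[ i < k ] ([ a i ] * (R * ([ b v i ] * μ v)))  ≡⟨ ∑-comm (λ v i → [ a i ] * (R * ([ b v i ] * μ v))) ⟩
      ∑[ i < k ] ∑[ v < l ] ([ a i ] * (R * ([ b v i ] * μ v)))  ≡⟨ sum-cong-≗ collect ⟨
      ∑[ i < k ] ([ a i ] * (R * ∑[ v < l ] ([ b v i ] * μ v)))  ∎
      where
      expand : ∀ v → R * count (λ i → a i ∧ b v i) * μ v ≡ ∑[ i < k ] ([ a i ] * (R * ([ b v i ] * μ v)))
      expand v = begin-equality
        R * count (λ i → a i ∧ b v i) * μ v                   ≡⟨ rearrange R (count (λ i → a i ∧ b v i)) (μ v) ⟩
        count (λ i → a i ∧ b v i) * (R * μ v)                 ≡⟨ *-distribʳ-sum (R * μ v) (λ i → [ a i ∧ b v i ]) ⟩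
        ∑[ i < k ] ([ a i ∧ b v i ] * (R * μ v))              ≡⟨ sum-cong-≗ (λ i → split (a i) (b v i)) ⟩
        ∑[ i < k ] ([ a i ] * (R * ([ b v i ] * μ v)))        ∎
        where
        rearrange : ∀ R c m → R * c * m ≡ c * (R * m)
        rearrange = solve-∀
        split : ∀ x y → [ x ∧ y ] * (R * μ v) ≡ [ x ] * (R * ([ y ] * μ v))
        split x y = trans (cong (_* (R * μ v)) ([∧]≡[]*[] x y)) (rearrange′ [ x ] [ y ] R (μ v))
          where
          rearrange′ : ∀ A B R m → A * B * (R * m) ≡ A * (R * (B * m))
          rearrange′ = solve-∀
      collect : ∀ i → [ a i ] * (R * ∑[ v < l ] ([ b v i ] * μ v)) ≡ ∑[ v < l ] ([ a i ] * (R * ([ b v i ] * μ v)))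
      collect i = trans (cong ([ a i ] *_) (*-distribˡ-sum R (λ v → [ b v i ] * μ v)))
                        (*-distribˡ-sum [ a i ] (λ v → R * ([ b v i ] * μ v)))

  module _ {n : ℕ} where
    open import Data.List.Membership.DecPropositional (_≟ᶠ_ {n}) using (_∈?_)

    _∈ᵇ_ : Fin n → List (Fin n) → Bool
    x ∈ᵇ L = does (x ∈? L)

    fresh : List (Fin n) → Fin n → Bool
    fresh L x = not (x ∈ᵇ L)

    fresh⇒∉ : ∀ {L : List (Fin n)} {x} → fresh L x ≡ true → x ∉ L
    fresh⇒∉ {L} {x} eq with x ∈? L
    ... | no x∉L = x∉L

  count-≟≡1 : ∀ {n} (y : Fin n) → count (λ x → does (x ≟ᶠ y)) ≡ 1
  count-≟≡1 {suc n} zero = cong suc (trans (∑-const n 0) (*-zeroʳ n))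
  count-≟≡1 (suc y) = count-≟≡1 y

  count-∈ᵇ≤length : ∀ {n} (L : List (Fin n)) → count (_∈ᵇ L) ≤ length L
  count-∈ᵇ≤length {n} [] = ≤-reflexive (trans (∑-const n 0) (*-zeroʳ n))
  count-∈ᵇ≤length {n} (y ∷ L) = begin
    count (_∈ᵇ (y ∷ L))                           ≤⟨ ∑-mono-≤ (λ x → [∨]≤ (does (x ≟ᶠ y)) (x ∈ᵇ L)) ⟩
    ∑[ x < n ] ([ does (x ≟ᶠ y) ] + [ x ∈ᵇ L ])   ≡⟨ ∑-distrib-+ (λ x → [ does (x ≟ᶠ y) ]) (λ x → [ x ∈ᵇ L ]) ⟩
    count (λ x → does (x ≟ᶠ y)) + count (_∈ᵇ L)   ≤⟨ +-mono-≤ (≤-reflexive (count-≟≡1 y)) (count-∈ᵇ≤length L) ⟩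
    suc (length L)                                ∎
    where
    open ≤-Reasoning
    [∨]≤ : ∀ a b → [ a ∨ b ] ≤ [ a ] + [ b ]
    [∨]≤ true b = m≤m+n 1 [ b ]
    [∨]≤ false b = ≤-refl

  count≤count-fresh+length : ∀ {n} (L : List (Fin n)) (p : Fin n → Bool) →
    count p ≤ count (λ x → fresh L x ∧ p x) + length L
  count≤count-fresh+length {n} L p = begin
    count p                                         ≤⟨ ∑-mono-≤ (λ x → pointwise (x ∈ᵇ L) (p x)) ⟩
    ∑[ x < n ] ([ fresh L x ∧ p x ] + [ x ∈ᵇ L ])   ≡⟨ ∑-distrib-+ (λ x → [ fresh L x ∧ p x ]) (λ x → [ x ∈ᵇ L ]) ⟩
    count (λ x → fresh L x ∧ p x) + count (_∈ᵇ L)   ≤⟨ +-monoʳ-≤ _ (count-∈ᵇ≤length L) ⟩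
    count (λ x → fresh L x ∧ p x) + length L        ∎
    where
    open ≤-Reasoning
    pointwise : ∀ d b → [ b ] ≤ [ not d ∧ b ] + [ d ]
    pointwise true b = ≤-trans ([]≤1 b) (m≤n+m 1 [ false ∧ b ])
    pointwise false b = m≤m+n [ b ] 0

module Density where
  open import Data.Nat
  open import Data.Nat.Properties
  open import Data.Nat.Tactic.RingSolver using (solve-∀)
  open import Data.Bool using (Bool; true; false; _∧_; if_then_else_)
  open import Data.Bool.Properties using (∧-assoc)
  open import Data.Fin using (Fin; zero; suc; fromℕ<)
  open import Data.Fin.Subset using (inside; outside; ∣_∣)
  open import Data.Vec using (tabulate)
  open import Data.List using (List; length)
  open import Data.List.Membership.Propositional using (_∉_)
  open import Data.Product using (∃; ∃₂; _×_; _,_)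
  open import Function using (_∘_)
  open import Data.Empty using (⊥-elim)
  open import Relation.Binary.PropositionalEquality using (_≡_; _≢_; refl; sym; trans; cong; cong₂; subst)
  open import Algebra.Properties.Semiring.Sum +-*-semiring using (sum-syntax; sum-cong-≗)
  open Counting

  0<n≤R*c⇒0<c : ∀ {n c} R → 0 < n → n ≤ R * c → 0 < c
  0<n≤R*c⇒0<c {c = zero} R 0<n n≤R*0 = ⊥-elim (<⇒≱ 0<n (≤-trans n≤R*0 (≤-reflexive (*-zeroʳ R))))
  0<n≤R*c⇒0<c {c = suc c} R _ _ = z<s

  ∣tabulate∣≡count : ∀ {k} (p : Fin k → Bool) →
    ∣ tabulate {n = k} (λ i → if p i then inside else outside) ∣ ≡ count p
  ∣tabulate∣≡count {zero} p = refl
  ∣tabulate∣≡count {suc k} p with p zero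
  ... | true = cong suc (∣tabulate∣≡count (p ∘ suc))
  ... | false = ∣tabulate∣≡count (p ∘ suc)

  deg≡count : ∀ {n} (G : Graph n) v → deg G v ≡ count (adj G v)
  deg≡count G v = ∣tabulate∣≡count (adj G v)

  adj⇒≢ : ∀ {n} (G : Graph n) {a b} → Adj G a b → a ≢ b
  adj⇒≢ G {a} ab refl with trans (sym ab) (adj-irr G a)
  ... | ()

  Adj-sym : ∀ {n} (G : Graph n) {a b} → Adj G a b → Adj G b a
  Adj-sym G {a} {b} ab = trans (adj-sym G b a) ab

  -- δ(G) ≥ (1/2 + 1/R) n, with the denominators cleared.
  record MinDegreeAboveHalf {n} (R : ℕ) (G : Graph n) : Set where
    field
      min-degree : ∀ v → (R + 2) * n ≤ 2 * R * deg G v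

  module _ {n R} {G : Graph n} (dense : MinDegreeAboveHalf R G) where
    open MinDegreeAboveHalf dense

    many-fresh-neighbours : ∀ (L : List (Fin n)) v → 2 * length L ≤ n →
      n ≤ R * count (λ y → fresh L y ∧ adj G v y)
    many-fresh-neighbours L v 2p≤n = *-cancelˡ-≤ 2 (+-cancelʳ-≤ (R * n) (2 * n) (2 * (R * X)) (begin
        2 * n + R * n               ≡⟨ +-comm (2 * n) (R * n) ⟩
        R * n + 2 * n               ≡⟨ *-distribʳ-+ n R 2 ⟨
        (R + 2) * n                 ≤⟨ min-degree v ⟩
        2 * R * deg G v             ≤⟨ *-monoʳ-≤ (2 * R) degree ⟩
        2 * R * (X + p)             ≡⟨ distribute R X p ⟩
        2 * (R * X) + R * (2 * p)   ≤⟨ +-monoʳ-≤ (2 * (R * X)) (*-monoʳ-≤ R 2p≤n) ⟩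
        2 * (R * X) + R * n         ∎))
      where
      open ≤-Reasoning
      X p : ℕ
      X = count (λ y → fresh L y ∧ adj G v y)
      p = length L
      degree : deg G v ≤ X + p
      degree = ≤-trans (≤-reflexive (deg≡count G v)) (count≤count-fresh+length L (adj G v))
      distribute : ∀ R X p → 2 * R * (X + p) ≡ 2 * (R * X) + R * (2 * p)
      distribute = solve-∀

    many-fresh-common-neighbours : ∀ (L : List (Fin n)) a b → R * length L ≤ n →
      n ≤ R * count (λ x → fresh L x ∧ (adj G a x ∧ adj G b x))
    many-fresh-common-neighbours L a b Rp≤n = *-cancelˡ-≤ 2 (+-cancelʳ-≤ K (2 * n) (2 * (R * Y)) (begin
        2 * n + K                                ≡⟨ twice R n ⟩
        (R + 2) * n + (R + 2) * n                ≤⟨ +-mono-≤ (min-degree a) (min-degree b) ⟩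
        2 * R * deg G a + 2 * R * deg G b        ≡⟨ *-distribˡ-+ (2 * R) (deg G a) (deg G b) ⟨
        2 * R * (deg G a + deg G b)              ≤⟨ *-monoʳ-≤ (2 * R) degrees ⟩
        2 * R * (Y + p + n)                      ≡⟨ distribute R Y p n ⟩
        2 * (R * Y) + (2 * (R * p) + 2 * R * n)
          ≤⟨ +-monoʳ-≤ (2 * (R * Y)) (+-monoˡ-≤ (2 * R * n) (*-monoʳ-≤ 2 Rp≤n)) ⟩
        2 * (R * Y) + K                          ∎))
      where
      open ≤-Reasoning
      Y p K : ℕ
      Y = count (λ x → fresh L x ∧ (adj G a x ∧ adj G b x))
      p = length L
      K = 2 * n + 2 * R * n
      twice : ∀ R n → 2 * n + (2 * n + 2 * R * n) ≡ (R + 2) * n + (R + 2) * n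
      twice = solve-∀
      degrees : deg G a + deg G b ≤ Y + p + n
      degrees = begin
        deg G a + deg G b                                  ≡⟨ cong₂ _+_ (deg≡count G a) (deg≡count G b) ⟩
        count (adj G a) + count (adj G b)                  ≤⟨ count+count≤count∧+size (adj G a) (adj G b) ⟩
        count (λ x → adj G a x ∧ adj G b x) + n
          ≤⟨ +-monoˡ-≤ n (count≤count-fresh+length L (λ x → adj G a x ∧ adj G b x)) ⟩
        Y + p + n                                          ∎
      distribute : ∀ R Y p n → 2 * R * (Y + p + n) ≡ 2 * (R * Y) + (2 * (R * p) + 2 * R * n)
      distribute = solve-∀

    fresh-absorbing-edge : ∀ (P : List (Fin n)) (μ : Fin n → ℕ) → 2 ≤ R → 0 < n → R * length P ≤ n →
      ∃₂ λ y x → y ∉ P × x ∉ P × Adj G y x ×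
        ∑[ v < n ] μ v ≤ R * R * ∑[ v < n ] ([ adj G v y ∧ adj G v x ] * μ v)
    fresh-absorbing-edge P μ 2≤R 0<n Rp≤n =
      let y , fresh-y , μ≤ = double-counting (fresh P) (adj G) μ R fresh-exists
                               (λ v → many-fresh-neighbours P v 2p≤n)
          μ′ : Fin n → ℕ
          μ′ v = [ adj G v y ] * μ v
          x , fresh-x∧yx , μ′≤ = double-counting (λ x → fresh P x ∧ adj G y x) (adj G) μ′ R
                                   (0<n≤R*c⇒0<c R 0<n (many-fresh-neighbours P y 2p≤n))
                                   (λ v → subst (λ c → n ≤ R * c)
                                            (count-cong (λ x → sym (∧-assoc (fresh P x) (adj G y x) (adj G v x))))
                                            (many-fresh-common-neighbours P y v Rp≤n))
          fresh-x , yx = ∧-true fresh-x∧yx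
      in y , x , fresh⇒∉ fresh-y , fresh⇒∉ fresh-x , yx , (begin
        ∑[ v < n ] μ v                                          ≤⟨ μ≤ ⟩
        R * ∑[ v < n ] μ′ v                                     ≤⟨ *-monoʳ-≤ R μ′≤ ⟩
        R * (R * ∑[ v < n ] ([ adj G v x ] * μ′ v))             ≡⟨ *-assoc R R _ ⟨
        R * R * ∑[ v < n ] ([ adj G v x ] * μ′ v)
          ≡⟨ cong (R * R *_) (sum-cong-≗ (λ v → merge (adj G v y) (adj G v x) (μ v))) ⟩
        R * R * ∑[ v < n ] ([ adj G v y ∧ adj G v x ] * μ v)    ∎)
      where
      open ≤-Reasoning
      2p≤n : 2 * length P ≤ n
      2p≤n = ≤-trans (*-monoˡ-≤ (length P) 2≤R) Rp≤n
      v₀ : Fin n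
      v₀ = fromℕ< 0<n
      fresh-exists : 0 < count (fresh P)
      fresh-exists = <-≤-trans (0<n≤R*c⇒0<c R 0<n (many-fresh-neighbours P v₀ 2p≤n))
                               (count∧≤count (fresh P) (adj G v₀))
      merge : ∀ a b m → [ b ] * ([ a ] * m) ≡ [ a ∧ b ] * m
      merge a b m = trans (sym (*-assoc [ b ] [ a ] m))
                          (cong (_* m) (trans (*-comm [ b ] [ a ]) (sym ([∧]≡[]*[] a b))))

    fresh-common-neighbour : ∀ (L : List (Fin n)) a b → 0 < n → R * length L ≤ n →
      ∃ λ z → z ∉ L × Adj G a z × Adj G b z
    fresh-common-neighbour L a b 0<n Rp≤n =
      let z , found = count-witness _ (0<n≤R*c⇒0<c R 0<n (many-fresh-common-neighbours L a b Rp≤n))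
          fresh-z , az∧bz = ∧-true found
          az , bz = ∧-true az∧bz
      in z , fresh⇒∉ fresh-z , az , bz

module Absorbers where
  open import Data.Nat using (ℕ; suc; _≤_; _<_; z≤n; s≤s; _+_)
  open import Data.Nat.Properties using (≤-trans; ≤-reflexive; +-monoʳ-≤; +-suc; ≤-pred; +-monoˡ-≤)
  open import Data.Bool using (Bool; true; false; _∧_)
  open import Data.Maybe using (Maybe; just; nothing)
  open import Data.Fin using (Fin)
  open import Data.List using (List; []; _∷_; _++_; length; head; last)
  open import Data.List.Properties using (++-assoc)
  open import Data.List.Membership.Propositional using (_∈_; _∉_)
  open import Data.List.Membership.Propositional.Properties using (∈-++⁺ˡ; ∈-++⁺ʳ; ∈-++⁻)
  open import Data.List.Relation.Unary.Any using (here; there)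
  open import Data.List.Relation.Unary.All as All using (All; _∷_)
  open import Data.List.Relation.Unary.All.Properties using (¬Any⇒All¬)
  open import Data.List.Relation.Unary.AllPairs using (_∷_)
  open import Data.List.Relation.Unary.Unique.Propositional using (Unique)
  open import Data.List.Relation.Unary.Linked using (Linked; [-]; _∷_)
  open import Data.List.Relation.Binary.Permutation.Propositional using (_↭_; ↭-sym; ↭-trans; ↭-swap; ↭-refl; ↭⇒↭ₛ)
  open import Data.List.Relation.Binary.Permutation.Propositional.Properties using (shift; ∈-resp-↭; ++⁺ˡ)
  open import Data.Product using (Σ; ∃; _×_; _,_)
  open import Data.Sum using (_⊎_; inj₁; inj₂; swap)
  open import Function.Bundles using (_⇔_; mk⇔)
  open import Function using (case_of_; _∘_)
  open import Relation.Binary.PropositionalEquality using (_≡_; _≢_; refl; sym; trans; cong; setoid)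
  open Counting using ([_]; []≤1; ∧-true)
  open Density using (adj⇒≢; Adj-sym)

  module _ {n : ℕ} where
    open import Data.List.Relation.Binary.Permutation.Setoid.Properties (setoid (Fin n)) using (Unique-resp-↭)

    unique-↭ : ∀ {xs ys : List (Fin n)} → xs ↭ ys → Unique xs → Unique ys
    unique-↭ xs↭ys = Unique-resp-↭ (↭⇒↭ₛ xs↭ys)

  unique-∷ : ∀ {A : Set} {x : A} {xs} → x ∉ xs → Unique xs → Unique (x ∷ xs)
  unique-∷ {xs = xs} x∉xs unique = ¬Any⇒All¬ xs x∉xs ∷ unique

  last-++-∷ : ∀ {A : Set} (xs : List A) {y ys} → last (xs ++ y ∷ ys) ≡ last (y ∷ ys)
  last-++-∷ [] = refl
  last-++-∷ (x ∷ []) = refl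
  last-++-∷ (x ∷ x′ ∷ xs) = last-++-∷ (x′ ∷ xs)

  linked-∷ : ∀ {A : Set} {R : A → A → Set} {x y ys} → head ys ≡ just y → R x y →
    Linked R ys → Linked R (x ∷ ys)
  linked-∷ {ys = _ ∷ _} refl xy L = xy ∷ L

  linked-++-replace : ∀ {A : Set} {R : A → A → Set} (xs : List A) {ys zs} → head ys ≡ head zs →
    (Linked R ys → Linked R zs) → Linked R (xs ++ ys) → Linked R (xs ++ zs)
  linked-++-replace [] _ f L = f L
  linked-++-replace (x ∷ []) {[]} {[]} _ _ [-] = [-]
  linked-++-replace (x ∷ []) {_ ∷ _} {_ ∷ _} refl f (xy ∷ L) = xy ∷ f L
  linked-++-replace (x ∷ x′ ∷ xs) eq f (xx′ ∷ L) = xx′ ∷ linked-++-replace (x′ ∷ xs) eq f L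

  -- A segment left ─ right ─ link of the path; a vertex adjacent to both left
  -- and right can later be put into the slot between them.
  record Absorber (n : ℕ) : Set where
    constructor absorber
    field
      left right link : Fin n
      slot : Maybe (Fin n)

  module _ {n : ℕ} where

    segment : Absorber n → List (Fin n)
    segment (absorber a b c nothing) = a ∷ b ∷ c ∷ []
    segment (absorber a b c (just u)) = a ∷ u ∷ b ∷ c ∷ []

    route : Fin n → List (Absorber n) → List (Fin n)
    route v₀ [] = v₀ ∷ []
    route v₀ (g ∷ gs) = segment g ++ route v₀ gs

    front : Fin n → List (Absorber n) → Fin n
    front v₀ [] = v₀
    front v₀ (g ∷ _) = Absorber.left g

    head-route : ∀ v₀ gs → head (route v₀ gs) ≡ just (front v₀ gs)
    head-route v₀ [] = refl
    head-route v₀ (absorber _ _ _ nothing ∷ gs) = refl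
    head-route v₀ (absorber _ _ _ (just _) ∷ gs) = refl

    route≢[] : ∀ v₀ gs → route v₀ gs ≢ []
    route≢[] v₀ [] ()
    route≢[] v₀ (absorber _ _ _ nothing ∷ gs) ()
    route≢[] v₀ (absorber _ _ _ (just _) ∷ gs) ()

    last-route : ∀ v₀ gs → last (route v₀ gs) ≡ just v₀
    last-route v₀ = go []
      where
      go : ∀ xs gs → last (xs ++ route v₀ gs) ≡ just v₀
      go xs [] = last-++-∷ xs
      go xs (g ∷ gs) =
        trans (cong last (sym (++-assoc xs (segment g) (route v₀ gs)))) (go (xs ++ segment g) gs)

  module _ {n : ℕ} (G : Graph n) where

    free : Fin n → Absorber n → Bool
    free u (absorber a b _ nothing) = adj G u a ∧ adj G u b
    free u (absorber _ _ _ (just _)) = false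

    available : Fin n → List (Absorber n) → ℕ
    available u [] = 0
    available u (g ∷ gs) = [ free u g ] + available u gs

    occupy : Fin n → Absorber n → Absorber n
    occupy u g = record g { slot = just u }

    fill : Fin n → List (Absorber n) → List (Absorber n)
    fill u [] = []
    fill u (g ∷ gs) with free u g
    ... | true = occupy u g ∷ gs
    ... | false = g ∷ fill u gs

    available-fill : ∀ v u gs → available v gs ≤ suc (available v (fill u gs))
    available-fill v u [] = z≤n
    available-fill v u (g ∷ gs) with free u g
    ... | true = +-monoˡ-≤ (available v gs) ([]≤1 (free v g))
    ... | false = ≤-trans (+-monoʳ-≤ [ free v g ] (available-fill v u gs)) (≤-reflexive (+-suc [ free v g ] _))

    front-fill : ∀ v₀ u gs → front v₀ (fill u gs) ≡ front v₀ gs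
    front-fill v₀ u [] = refl
    front-fill v₀ u (g ∷ gs) with free u g
    ... | true = refl
    ... | false = refl

    head-route-fill : ∀ v₀ u gs → head (route v₀ (fill u gs)) ≡ head (route v₀ gs)
    head-route-fill v₀ u gs =
      trans (head-route v₀ (fill u gs)) (trans (cong just (front-fill v₀ u gs)) (sym (head-route v₀ gs)))

    route-occupy-↭ : ∀ v₀ u g gs → free u g ≡ true → route v₀ (occupy u g ∷ gs) ↭ u ∷ route v₀ (g ∷ gs)
    route-occupy-↭ v₀ u (absorber a b c nothing) gs _ = ↭-swap a u ↭-refl

    route-fill-↭ : ∀ v₀ u gs → 0 < available u gs → route v₀ (fill u gs) ↭ u ∷ route v₀ gs
    route-fill-↭ v₀ u (g ∷ gs) pos with free u g in free-u
    ... | true = route-occupy-↭ v₀ u g gs free-u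
    ... | false = ↭-trans (++⁺ˡ (segment g) (route-fill-↭ v₀ u gs pos)) (shift u (segment g) (route v₀ gs))

    linked-occupy : ∀ v₀ u g gs → free u g ≡ true →
      Linked (Adj G) (route v₀ (g ∷ gs)) → Linked (Adj G) (route v₀ (occupy u g ∷ gs))
    linked-occupy v₀ u (absorber a b c nothing) gs free-u (_ ∷ L) =
      let ua , ub = ∧-true free-u in Adj-sym G ua ∷ ub ∷ L

    linked-fill : ∀ v₀ u gs → Linked (Adj G) (route v₀ gs) → Linked (Adj G) (route v₀ (fill u gs))
    linked-fill v₀ u [] L = L
    linked-fill v₀ u (g ∷ gs) L with free u g in free-u
    ... | true = linked-occupy v₀ u g gs free-u L
    ... | false = linked-++-replace (segment g) (sym (head-route-fill v₀ u gs)) (linked-fill v₀ u gs) L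

    fill-path : ∀ v₀ u gs → 0 < available u gs → u ∉ route v₀ gs →
      IsPath G (route v₀ gs) → IsPath G (route v₀ (fill u gs))
    fill-path v₀ u gs pos u∉route (_ , unique , linked) =
      route≢[] v₀ (fill u gs) ,
      unique-↭ (↭-sym (route-fill-↭ v₀ u gs pos)) (unique-∷ u∉route unique) ,
      linked-fill v₀ u gs linked

    prepend-path : ∀ v₀ gs {y x z} → y ∉ route v₀ gs → x ∉ route v₀ gs → z ∉ y ∷ route v₀ gs →
      Adj G y x → Adj G x z → Adj G z (front v₀ gs) →
      IsPath G (route v₀ gs) → IsPath G (route v₀ (absorber y x z nothing ∷ gs))
    prepend-path v₀ gs {y} {x} {z} y∉P x∉P z∉yP yx xz zs (_ , unique , linked) =
      (λ ()) ,
      unique-∷ y∉xzP (unique-∷ x∉zP (unique-∷ (z∉yP ∘ there) unique)) ,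
      yx ∷ xz ∷ linked-∷ (head-route v₀ gs) zs linked
      where
      y∉xzP : y ∉ x ∷ z ∷ route v₀ gs
      y∉xzP (here y≡x) = adj⇒≢ G yx y≡x
      y∉xzP (there (here y≡z)) = z∉yP (here (sym y≡z))
      y∉xzP (there (there y∈P)) = y∉P y∈P
      x∉zP : x ∉ z ∷ route v₀ gs
      x∉zP (here x≡z) = adj⇒≢ G xz x≡z
      x∉zP (there x∈P) = x∉P x∈P

    ∉-route-fill : ∀ v₀ u gs {v} → 0 < available u gs → u ≢ v → v ∉ route v₀ gs → v ∉ route v₀ (fill u gs)
    ∉-route-fill v₀ u gs pos u≢v v∉route v∈route′ = case ∈-resp-↭ (route-fill-↭ v₀ u gs pos) v∈route′ of λ
      { (here v≡u) → u≢v (sym v≡u) ; (there v∈route) → v∉route v∈route }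

    absorb-all : ∀ v₀ (us : List (Fin n)) gs → Unique us → All (_∉ route v₀ gs) us →
      All (λ u → length us ≤ available u gs) us → IsPath G (route v₀ gs) →
      ∃ λ gs′ → IsPath G (route v₀ gs′) × front v₀ gs′ ≡ front v₀ gs × route v₀ gs′ ↭ us ++ route v₀ gs
    absorb-all v₀ [] gs _ _ _ path = gs , path , refl , ↭-refl
    absorb-all v₀ (u ∷ us) gs (u≢us ∷ unique-us) (u∉route ∷ us∉route) (enough-u ∷ enough-us) path =
      let gs′ , path′ , front′ , perm = absorb-all v₀ us (fill u gs) unique-us us∉route′ enough-us′
                                          (fill-path v₀ u gs pos u∉route path)
      in gs′ , path′ , trans front′ (front-fill v₀ u gs) ,
         ↭-trans perm (↭-trans (++⁺ˡ us (route-fill-↭ v₀ u gs pos)) (shift u us (route v₀ gs)))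
      where
      pos : 0 < available u gs
      pos = ≤-trans (s≤s z≤n) enough-u
      us∉route′ : All (_∉ route v₀ (fill u gs)) us
      us∉route′ = All.zipWith (λ (u≢v , v∉route) → ∉-route-fill v₀ u gs pos u≢v v∉route) (u≢us , us∉route)
      enough-us′ : All (λ v → length us ≤ available v (fill u gs)) us
      enough-us′ = All.map (λ {v} enough-v → ≤-pred (≤-trans enough-v (available-fill v u gs))) enough-us

    absorbing-route : ∀ v₀ gs (us : List (Fin n)) → IsPath G (route v₀ gs) → Unique us →
      All (_∉ route v₀ gs) us → All (λ u → length us ≤ available u gs) us →
      Σ (List (Fin n)) λ AU → IsPath G AU × SameEndpoints AU (route v₀ gs) ×
        (∀ x → (x ∈ AU) ⇔ ((x ∈ route v₀ gs) ⊎ (x ∈ us)))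
    absorbing-route v₀ gs us path unique-us us∉route enough =
      let gs′ , path′ , front′ , perm = absorb-all v₀ us gs unique-us us∉route enough path
      in route v₀ gs′ , path′ ,
         (trans (head-route v₀ gs′) (trans (cong just front′) (sym (head-route v₀ gs))) ,
          trans (last-route v₀ gs′) (sym (last-route v₀ gs))) ,
         λ x → mk⇔ (swap ∘ ∈-++⁻ us ∘ ∈-resp-↭ perm) (∈-resp-↭ (↭-sym perm) ∘ ∈-++⁺)
      where
      ∈-++⁺ : ∀ {x} → x ∈ route v₀ gs ⊎ x ∈ us → x ∈ us ++ route v₀ gs
      ∈-++⁺ (inj₁ x∈route) = ∈-++⁺ʳ us x∈route
      ∈-++⁺ (inj₂ x∈us) = ∈-++⁺ˡ x∈us

module Decay where
  open import Data.Nat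
  open import Data.Nat.Properties
  open import Data.Nat.Tactic.RingSolver using (solve-∀)
  open import Data.Bool using (true; false)
  open import Data.Empty using (⊥-elim)
  open import Relation.Binary.PropositionalEquality using (_≡_; refl; sym; trans; cong; subst)
  open Counting using ([_])

  -- weight d = 2 ^ d ∸ 1 and marginal d = weight d ∸ weight (d ∸ 1).
  weight : ℕ → ℕ
  weight zero = 0
  weight (suc d) = 2 ^ d + weight d

  marginal : ℕ → ℕ
  marginal zero = 0
  marginal (suc d) = 2 ^ d

  weight-∸ : ∀ d b → weight d ≡ weight (d ∸ [ b ]) + [ b ] * marginal d
  weight-∸ d false = sym (+-identityʳ (weight d))
  weight-∸ zero true = refl
  weight-∸ (suc d) true = trans (+-comm (2 ^ d) (weight d)) (cong (weight d +_) (sym (+-identityʳ (2 ^ d))))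

  weight<2^ : ∀ d → weight d < 2 ^ d
  weight<2^ zero = s≤s z≤n
  weight<2^ (suc d) =
    ≤-trans (+-monoʳ-< (2 ^ d) (weight<2^ d)) (≤-reflexive (cong (2 ^ d +_) (sym (+-identityʳ (2 ^ d)))))

  weight≤2*marginal : ∀ d → weight d ≤ 2 * marginal d
  weight≤2*marginal zero = z≤n
  weight≤2*marginal (suc d) =
    ≤-trans (+-monoʳ-≤ (2 ^ d) (<⇒≤ (weight<2^ d))) (≤-reflexive (cong (2 ^ d +_) (sym (+-identityʳ (2 ^ d)))))

  weight≡0⇒≡0 : ∀ d → weight d ≡ 0 → d ≡ 0
  weight≡0⇒≡0 zero _ = refl
  weight≡0⇒≡0 (suc d) eq = ⊥-elim (<⇒≱ (m^n>0 2 d) (≤-trans (m≤m+n (2 ^ d) (weight d)) (≤-reflexive eq)))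

  decay-step : ∀ E {Φ Φ′ g} → Φ ≡ Φ′ + g → Φ ≤ suc E * g → suc E * Φ′ ≤ E * Φ
  decay-step E {Φ} {Φ′} {g} Φ≡Φ′+g Φ≤g = +-cancelʳ-≤ Φ (suc E * Φ′) (E * Φ) (begin
    suc E * Φ′ + Φ           ≤⟨ +-monoʳ-≤ (suc E * Φ′) Φ≤g ⟩
    suc E * Φ′ + suc E * g   ≡⟨ *-distribˡ-+ (suc E) Φ′ g ⟨
    suc E * (Φ′ + g)         ≡⟨ cong (suc E *_) Φ≡Φ′+g ⟨
    suc E * Φ                ≡⟨ +-comm Φ (E * Φ) ⟩
    E * Φ + Φ                ∎)
    where open ≤-Reasoning

  decay-iterate : ∀ E k {Φ₀ Φ Φ′} → suc E ^ k * Φ ≤ E ^ k * Φ₀ → suc E * Φ′ ≤ E * Φ →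
    suc E ^ suc k * Φ′ ≤ E ^ suc k * Φ₀
  decay-iterate E k {Φ₀} {Φ} {Φ′} decayed step = begin
    suc E ^ suc k * Φ′       ≡⟨ *-assoc (suc E) (suc E ^ k) Φ′ ⟩
    suc E * (suc E ^ k * Φ′) ≡⟨ x*[y*z]≡y*[x*z] (suc E) (suc E ^ k) Φ′ ⟩
    suc E ^ k * (suc E * Φ′) ≤⟨ *-monoʳ-≤ (suc E ^ k) step ⟩
    suc E ^ k * (E * Φ)      ≡⟨ x*[y*z]≡y*[x*z] (suc E ^ k) E Φ ⟩
    E * (suc E ^ k * Φ)      ≤⟨ *-monoʳ-≤ E decayed ⟩
    E * (E ^ k * Φ₀)         ≡⟨ *-assoc E (E ^ k) Φ₀ ⟨
    E ^ suc k * Φ₀           ∎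
    where
    open ≤-Reasoning
    x*[y*z]≡y*[x*z] : ∀ x y z → x * (y * z) ≡ y * (x * z)
    x*[y*z]≡y*[x*z] = solve-∀

  bernoulli : ∀ N x → x ^ suc N + suc N * x ^ N ≤ suc x ^ suc N
  bernoulli zero x = ≤-reflexive (base x)
    where
    base : ∀ x → x * 1 + 1 * 1 ≡ suc x * 1
    base = solve-∀
  bernoulli (suc N) x = begin
    x * x ^ suc N + suc (suc N) * (x * x ^ N)                        ≤⟨ m≤m+n _ (suc N * x ^ N) ⟩
    x * x ^ suc N + suc (suc N) * (x * x ^ N) + suc N * x ^ N        ≡⟨ expand x N (x ^ N) ⟩
    suc x * (x ^ suc N + suc N * x ^ N)                              ≤⟨ *-monoʳ-≤ (suc x) (bernoulli N x) ⟩
    suc x * suc x ^ suc N                                            ∎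
    where
    open ≤-Reasoning
    expand : ∀ x N a → x * (x * a) + suc (suc N) * (x * a) + suc N * a ≡ suc x * (x * a + suc N * a)
    expand = solve-∀

  2*E^[1+E]≤[1+E]^[1+E] : ∀ E → 2 * E ^ suc E ≤ suc E ^ suc E
  2*E^[1+E]≤[1+E]^[1+E] E = begin
    2 * E ^ suc E                  ≡⟨ cong (E ^ suc E +_) (+-identityʳ (E ^ suc E)) ⟩
    E ^ suc E + E * E ^ E          ≤⟨ +-monoʳ-≤ (E ^ suc E) (*-monoˡ-≤ (E ^ E) (n≤1+n E)) ⟩
    E ^ suc E + suc E * E ^ E      ≤⟨ bernoulli E E ⟩
    suc E ^ suc E                  ∎
    where open ≤-Reasoning

  2^j*E^[[1+E]*j]≤[1+E]^[[1+E]*j] : ∀ E j → 2 ^ j * E ^ (suc E * j) ≤ suc E ^ (suc E * j)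
  2^j*E^[[1+E]*j]≤[1+E]^[[1+E]*j] E zero rewrite *-zeroʳ (suc E) = ≤-refl
  2^j*E^[[1+E]*j]≤[1+E]^[[1+E]*j] E (suc j) = begin
    2 ^ suc j * E ^ (suc E * suc j)                 ≡⟨ cong (λ t → 2 ^ suc j * E ^ t) (*-suc (suc E) j) ⟩
    2 ^ suc j * E ^ (suc E + suc E * j)             ≡⟨ cong (2 ^ suc j *_) (^-distribˡ-+-* E (suc E) (suc E * j)) ⟩
    2 ^ suc j * (E ^ suc E * E ^ (suc E * j))       ≡⟨ regroup 2 (2 ^ j) (E ^ suc E) (E ^ (suc E * j)) ⟩
    2 * E ^ suc E * (2 ^ j * E ^ (suc E * j))
      ≤⟨ *-mono-≤ (2*E^[1+E]≤[1+E]^[1+E] E) (2^j*E^[[1+E]*j]≤[1+E]^[[1+E]*j] E j) ⟩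
    suc E ^ suc E * suc E ^ (suc E * j)             ≡⟨ ^-distribˡ-+-* (suc E) (suc E) (suc E * j) ⟨
    suc E ^ (suc E + suc E * j)                     ≡⟨ cong (suc E ^_) (*-suc (suc E) j) ⟨
    suc E ^ (suc E * suc j)                         ∎
    where
    open ≤-Reasoning
    regroup : ∀ t a b c → t * a * (b * c) ≡ t * b * (a * c)
    regroup = solve-∀

  decayed-to-zero : ∀ E j {Φ₀ Φ} → Φ₀ ≤ 2 ^ j → suc E ^ (suc E * suc j) * Φ ≤ E ^ (suc E * suc j) * Φ₀ →
    Φ ≡ 0
  decayed-to-zero E j {Φ₀} {Φ} Φ₀≤2^j decayed =
    2*Φ≤1⇒Φ≡0 Φ (*-cancelˡ-≤ (suc E ^ K) {{m^n≢0 (suc E) K}} (begin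
    suc E ^ K * (2 * Φ)     ≡⟨ x*[y*z]≡y*[x*z] (suc E ^ K) 2 Φ ⟩
    2 * (suc E ^ K * Φ)     ≤⟨ *-monoʳ-≤ 2 (≤-trans decayed (*-monoʳ-≤ (E ^ K) Φ₀≤2^j)) ⟩
    2 * (E ^ K * 2 ^ j)     ≡⟨ x*[y*z]≡y*[x*z] 2 (E ^ K) (2 ^ j) ⟩
    E ^ K * 2 ^ suc j       ≡⟨ *-comm (E ^ K) (2 ^ suc j) ⟩
    2 ^ suc j * E ^ K       ≤⟨ 2^j*E^[[1+E]*j]≤[1+E]^[[1+E]*j] E (suc j) ⟩
    suc E ^ K               ≡⟨ *-identityʳ (suc E ^ K) ⟨
    suc E ^ K * 1           ∎))
    where
    open ≤-Reasoning
    K : ℕ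
    K = suc E * suc j
    x*[y*z]≡y*[x*z] : ∀ x y z → x * (y * z) ≡ y * (x * z)
    x*[y*z]≡y*[x*z] = solve-∀
    2*Φ≤1⇒Φ≡0 : ∀ Φ → 2 * Φ ≤ 1 → Φ ≡ 0
    2*Φ≤1⇒Φ≡0 zero _ = refl
    2*Φ≤1⇒Φ≡0 (suc Φ) (s≤s 2Φ+1≤0) with subst (_≤ 0) (+-suc Φ (Φ + 0)) 2Φ+1≤0
    ... | ()

module AbsorbingPath where
  open import Data.Nat
  open import Data.Nat.Properties
  open import Data.Nat.Tactic.RingSolver using (solve-∀)
  open import Data.Bool using (_∧_)
  open import Data.Maybe using (nothing)
  open import Data.Fin using (Fin; fromℕ<)
  open import Data.Fin.Properties using (toℕ<n)
  open import Data.List using (List; []; _∷_; length)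
  open import Data.List.Membership.Propositional using (_∈_; _∉_)
  open import Data.List.Relation.Unary.All as All using (All)
  open import Data.List.Relation.Unary.AllPairs using ([])
  open import Data.List.Relation.Unary.Linked using ([-])
  open import Data.List.Relation.Unary.Unique.Propositional using (Unique)
  open import Data.Product using (Σ; ∃; ∃₂; _×_; _,_)
  open import Data.Sum using (_⊎_)
  open import Function.Bundles using (_⇔_)
  open import Relation.Binary.PropositionalEquality using (_≡_; refl; sym; trans; cong; subst)
  open import Algebra.Properties.Semiring.Sum +-*-semiring
    using (sum; sum-syntax; sum-cong-≗; ∑-distrib-+; *-distribˡ-sum)
  open Counting
  open Density
  open Absorbers
  open Decay

  1+pred[2*R*R]≡2*R*R : ∀ R → 1 ≤ R → suc (pred (2 * R * R)) ≡ 2 * R * R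
  1+pred[2*R*R]≡2*R*R (suc r) _ = refl

  module Greedy {n R} {G : Graph n} (2≤R : 2 ≤ R) (dense : MinDegreeAboveHalf R G) (m : ℕ) (v₀ : Fin n) where

    potential : List (Absorber n) → ℕ
    potential gs = ∑[ v < n ] weight (m ∸ available G v gs)

    gain : List (Absorber n) → Absorber n → ℕ
    gain gs g = ∑[ v < n ] ([ free G v g ] * marginal (m ∸ available G v gs))

    potential-∷ : ∀ g gs → potential gs ≡ potential (g ∷ gs) + gain gs g
    potential-∷ g gs = trans (sum-cong-≗ pointwise) (∑-distrib-+ (λ v → weight (m ∸ available G v (g ∷ gs))) _)
      where
      pointwise : ∀ v → weight (m ∸ available G v gs) ≡
                        weight (m ∸ available G v (g ∷ gs)) + [ free G v g ] * marginal (m ∸ available G v gs)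
      pointwise v = trans (weight-∸ (m ∸ a) (free G v g)) (cong (λ d → weight d + b * marginal (m ∸ a)) m∸a∸b≡m∸[b+a])
        where
        a b : ℕ
        a = available G v gs
        b = [ free G v g ]
        m∸a∸b≡m∸[b+a] : m ∸ a ∸ b ≡ m ∸ (b + a)
        m∸a∸b≡m∸[b+a] = trans (∸-+-assoc m a b) (cong (m ∸_) (+-comm a b))

    potential-[] : potential [] ≤ n * 2 ^ m
    potential-[] = ≤-trans (≤-reflexive (∑-const n (weight m))) (*-monoʳ-≤ n (<⇒≤ (weight<2^ m)))

    potential≡0⇒enough : ∀ gs → potential gs ≡ 0 → ∀ v → m ≤ available G v gs
    potential≡0⇒enough gs Φ≡0 v = m∸n≡0⇒m≤n (weight≡0⇒≡0 _ (n≤0⇒n≡0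
      (≤-trans (term≤∑ (λ v → weight (m ∸ available G v gs)) v) (≤-reflexive Φ≡0))))

    -- suc E = 2R², and each step keeps at most a fraction E / suc E of the potential.
    E : ℕ
    E = pred (2 * R * R)

    0<n : 0 < n
    0<n = ≤-trans (s≤s z≤n) (toℕ<n v₀)

    marginals : List (Absorber n) → Fin n → ℕ
    marginals gs v = marginal (m ∸ available G v gs)

    potential≤gain : ∀ gs {y x z} →
      sum (marginals gs) ≤ R * R * ∑[ v < n ] ([ adj G v y ∧ adj G v x ] * marginals gs v) →
      potential gs ≤ suc E * gain gs (absorber y x z nothing)
    potential≤gain gs {y} {x} {z} μ≤ = begin
      potential gs                      ≤⟨ ∑-mono-≤ (λ v → weight≤2*marginal (m ∸ available G v gs)) ⟩
      ∑[ v < n ] (2 * marginals gs v)   ≡⟨ *-distribˡ-sum 2 (marginals gs) ⟨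
      2 * sum (marginals gs)            ≤⟨ *-monoʳ-≤ 2 μ≤ ⟩
      2 * (R * R * g)                   ≡⟨ regroup R g ⟩
      2 * R * R * g                     ≡⟨ cong (_* g) (1+pred[2*R*R]≡2*R*R R (≤-trans (s≤s z≤n) 2≤R)) ⟨
      suc E * g                         ∎
      where
      open ≤-Reasoning
      g : ℕ
      g = gain gs (absorber y x z nothing)
      regroup : ∀ R g → 2 * (R * R * g) ≡ 2 * R * R * g
      regroup = solve-∀

    record Stage (k : ℕ) : Set where
      field
        absorbers : List (Absorber n)
        path : IsPath G (route v₀ absorbers)
        size : length (route v₀ absorbers) ≡ 3 * k + 1
        decayed : suc E ^ k * potential absorbers ≤ E ^ k * potential []

    extend : ∀ k → R * (3 * k + 2) ≤ n → Stage k → Stage (suc k)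
    extend k room st =
      with-edge (fresh-absorbing-edge dense P (marginals gs) 2≤R 0<n (≤-trans (*-monoʳ-≤ R (n≤1+n _)) room-yP))
      where
      open Stage st renaming (absorbers to gs)
      P : List (Fin n)
      P = route v₀ gs
      room-yP : R * suc (length P) ≤ n
      room-yP = subst (λ l → R * l ≤ n) (trans (+-suc (3 * k) 1) (cong suc (sym size))) room
      with-edge : (∃₂ λ y x → y ∉ P × x ∉ P × Adj G y x ×
                    sum (marginals gs) ≤ R * R * ∑[ v < n ] ([ adj G v y ∧ adj G v x ] * marginals gs v)) →
                  Stage (suc k)
      with-edge (y , x , y∉P , x∉P , yx , μ≤) =
        with-link (fresh-common-neighbour dense (y ∷ P) (front v₀ gs) x 0<n room-yP)
        where
        with-link : (∃ λ z → z ∉ y ∷ P × Adj G (front v₀ gs) z × Adj G x z) → Stage (suc k)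
        with-link (z , z∉yP , sz , xz) = record
          { absorbers = absorber y x z nothing ∷ gs
          ; path = prepend-path G v₀ gs y∉P x∉P z∉yP yx xz (Adj-sym G sz) path
          ; size = trans (cong (3 +_) size) (3+[3k+1]≡3[1+k]+1 k)
          ; decayed = decay-iterate E k decayed
                        (decay-step E (potential-∷ (absorber y x z nothing) gs) (potential≤gain gs {z = z} μ≤))
          }
          where
          3+[3k+1]≡3[1+k]+1 : ∀ k → 3 + (3 * k + 1) ≡ 3 * suc k + 1
          3+[3k+1]≡3[1+k]+1 = solve-∀

    build : ∀ k → R * (3 * k + 2) ≤ n → Stage k
    build zero _ = record
      { absorbers = [] ; path = (λ ()) , unique-∷ (λ ()) [] , [-] ; size = refl ; decayed = ≤-refl }
    build (suc k) room = extend k room′ (build k room′)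
      where
      room′ : R * (3 * k + 2) ≤ n
      room′ = ≤-trans (*-monoʳ-≤ R (+-monoˡ-≤ 2 (*-monoʳ-≤ 3 (n≤1+n k)))) room

  3K+2≤[36D+2]m : ∀ E m → 1 ≤ m → 3 * (suc E * suc (11 * m)) + 2 ≤ (36 * suc E + 2) * m
  3K+2≤[36D+2]m E (suc k) _ = ≤-trans (m≤m+n _ (3 * suc E * k + 2 * k)) (≤-reflexive (expand E k))
    where
    expand : ∀ E k → 3 * (suc E * suc (11 * suc k)) + 2 + (3 * suc E * k + 2 * k) ≡ (36 * suc E + 2) * suc k
    expand = solve-∀

  absorbing-path : ∀ {n R m} (G : Graph n) → 2 ≤ R → MinDegreeAboveHalf R G → 0 < n → 1 ≤ m →
    n ≤ 2 ^ (10 * m) → R * (36 * (2 * R * R) + 2) * m ≤ n →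
    Σ (List (Fin n)) λ A → IsPath G A × length A ≤ R * (36 * (2 * R * R) + 2) * m ×
      (∀ (us : List (Fin n)) → Unique us → All (_∉ A) us → length us ≤ m →
        Σ (List (Fin n)) λ AU → IsPath G AU × SameEndpoints AU A × (∀ x → (x ∈ AU) ⇔ ((x ∈ A) ⊎ (x ∈ us))))
  absorbing-path {n} {R} {m} G 2≤R dense 0<n 1≤m n≤2^10m Cm≤n = route v₀ gs , path , length≤ , absorb
    where
    v₀ : Fin n
    v₀ = fromℕ< 0<n
    open Greedy 2≤R dense m v₀
    D K : ℕ
    D = 2 * R * R
    -- K steps shrink the initial potential, below 2 ^ (11 * m), to zero.
    K = suc E * suc (11 * m)
    3K+2≤ : 3 * K + 2 ≤ (36 * D + 2) * m
    3K+2≤ = subst (λ D → 3 * K + 2 ≤ (36 * D + 2) * m) (1+pred[2*R*R]≡2*R*R R (≤-trans (s≤s z≤n) 2≤R))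
                  (3K+2≤[36D+2]m E m 1≤m)
    room : R * (3 * K + 2) ≤ n
    room = ≤-trans (*-monoʳ-≤ R 3K+2≤) (≤-trans (≤-reflexive (sym (*-assoc R (36 * D + 2) m))) Cm≤n)
    open Stage (build K room) renaming (absorbers to gs)
    n*2^m≤2^11m : n * 2 ^ m ≤ 2 ^ (11 * m)
    n*2^m≤2^11m = ≤-trans (*-monoˡ-≤ (2 ^ m) n≤2^10m)
      (≤-reflexive (trans (sym (^-distribˡ-+-* 2 (10 * m) m)) (cong (2 ^_) (10m+m≡11m m))))
      where
      10m+m≡11m : ∀ m → 10 * m + m ≡ 11 * m
      10m+m≡11m = solve-∀
    potential≡0 : potential gs ≡ 0
    potential≡0 = decayed-to-zero E (11 * m) (≤-trans potential-[] n*2^m≤2^11m) decayed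
    length≤ : length (route v₀ gs) ≤ R * (36 * D + 2) * m
    length≤ = begin
      length (route v₀ gs)       ≡⟨ size ⟩
      3 * K + 1                  ≤⟨ +-monoʳ-≤ (3 * K) (n≤1+n 1) ⟩
      3 * K + 2                  ≤⟨ 3K+2≤ ⟩
      (36 * D + 2) * m           ≤⟨ m≤n*m _ R {{>-nonZero (≤-trans (s≤s z≤n) 2≤R)}} ⟩
      R * ((36 * D + 2) * m)     ≡⟨ *-assoc R (36 * D + 2) m ⟨
      R * (36 * D + 2) * m       ∎
      where open ≤-Reasoning
    absorb : ∀ (us : List (Fin n)) → Unique us → All (_∉ route v₀ gs) us → length us ≤ m →
      Σ (List (Fin n)) λ AU → IsPath G AU × SameEndpoints AU (route v₀ gs) ×
        (∀ x → (x ∈ AU) ⇔ ((x ∈ route v₀ gs) ⊎ (x ∈ us)))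
    absorb us unique-us us∉A us≤m = absorbing-route G v₀ gs us path unique-us us∉A
      (All.tabulate (λ {u} _ → ≤-trans us≤m (potential≡0⇒enough gs potential≡0 u)))

module Logarithm where
  open import Data.Nat
  open import Data.Nat.Properties
  open import Data.Nat.Tactic.RingSolver using (solve-∀)
  open import Data.Nat.Combinatorics using (_P_; nPk≡n!/[n∸k]!)
  open import Data.Nat.DivMod using (m/n*n≤m)
  open import Data.Nat.ListAction using () renaming (sum to sumᴸ)
  open import Data.Fin using (Fin; zero; suc; toℕ)
  open import Data.Fin.Properties using (toℕ≤pred[n])
  open import Data.List using (map; applyUpTo)
  open import Data.Product using (∃; _×_; _,_)
  open import Data.Empty using (⊥-elim)
  open import Function using (_∘_)
  open import Relation.Binary.PropositionalEquality using (_≡_; refl; sym; trans; cong; cong₂; subst)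
  open import Relation.Nullary using (yes; no)
  open import Algebra.Properties.Semiring.Sum +-*-semiring
    using (sum; sum-syntax; ∑-distrib-+; *-distribˡ-sum)

  sumᴸ-map-applyUpTo : ∀ (f g : ℕ → ℕ) N → sumᴸ (map f (applyUpTo g N)) ≡ ∑[ i < N ] f (g (toℕ i))
  sumᴸ-map-applyUpTo f g zero = refl
  sumᴸ-map-applyUpTo f g (suc N) = cong (f (g 0) +_) (sumᴸ-map-applyUpTo f (g ∘ suc) N)

  geometric : ∀ {N} (h : Fin N → ℕ) X Y → (∀ i → h i * 2 ^ toℕ i * Y ≤ X) → sum h * Y ≤ 2 * X
  geometric {zero} h X Y bound = z≤n
  geometric {suc N} h X Y bound = begin
    (h zero + sum (h ∘ suc)) * Y          ≡⟨ *-distribʳ-+ Y (h zero) (sum (h ∘ suc)) ⟩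
    h zero * Y + sum (h ∘ suc) * Y        ≤⟨ +-mono-≤ head-bound tail-bound ⟩
    X + X                                 ≡⟨ cong (X +_) (+-identityʳ X) ⟨
    2 * X                                 ∎
    where
    open ≤-Reasoning
    head-bound : h zero * Y ≤ X
    head-bound = subst (_≤ X) (cong (_* Y) (*-identityʳ (h zero))) (bound zero)
    tail-bound : sum (h ∘ suc) * Y ≤ X
    tail-bound = *-cancelˡ-≤ 2 (subst (_≤ 2 * X) (regroup₁ (sum (h ∘ suc)) Y)
      (geometric (h ∘ suc) X (2 * Y) (λ i → subst (_≤ X) (regroup₂ (h (suc i)) (2 ^ toℕ i) Y) (bound (suc i)))))
      where
      regroup₁ : ∀ a Y → a * (2 * Y) ≡ 2 * (a * Y)
      regroup₁ = solve-∀
      regroup₂ : ∀ a b Y → a * (2 * b) * Y ≡ a * b * (2 * Y)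
      regroup₂ = solve-∀

  ^≤!*^ : ∀ x j → x ^ j ≤ j ! * x ^ x
  ^≤!*^ x zero = ≤-trans (x^x≥1 x) (m≤m+n (x ^ x) 0)
    where
    x^x≥1 : ∀ x → 1 ≤ x ^ x
    x^x≥1 zero = ≤-refl
    x^x≥1 (suc x) = m^n>0 (suc x) (suc x)
  ^≤!*^ x (suc j) with x ≤? suc j
  ... | yes x≤1+j = ≤-trans (*-mono-≤ x≤1+j (^≤!*^ x j)) (≤-reflexive (sym (*-assoc (suc j) (j !) (x ^ x))))
  ... | no x≰1+j = ≤-trans (^-monoʳ-≤ x {{>-nonZero (≤-trans z<s (≰⇒> x≰1+j))}} (<⇒≤ (≰⇒> x≰1+j)))
                           (m≤n*m (x ^ x) (suc j !) {{suc j !≢0}})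

  P*!≤! : ∀ K j → j ≤ K → (K P (K ∸ j)) * j ! ≤ K !
  P*!≤! K j j≤K rewrite nPk≡n!/[n∸k]! (m∸n≤m K j) | m∸[m∸n]≡n j≤K = m/n*n≤m (K !) (j !) {{j !≢0}}

  ^-distribʳ-* : ∀ a b j → (a * b) ^ j ≡ a ^ j * b ^ j
  ^-distribʳ-* a b zero = refl
  ^-distribʳ-* a b (suc j) = trans (cong ((a * b) *_) (^-distribʳ-* a b j)) (regroup a b (a ^ j) (b ^ j))
    where
    regroup : ∀ a b x y → a * b * (x * y) ≡ a * x * (b * y)
    regroup = solve-∀

  -- With K! / j! = K P (K ∸ j), this says s ^ j / j! ≤ (2 s) ^ (2 s) / 2 ^ j.
  taylor-term≤ : ∀ K j s → j ≤ K → s ^ j * (K P (K ∸ j)) * 2 ^ j ≤ K ! * (2 * s) ^ (2 * s)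
  taylor-term≤ K j s j≤K = begin
    s ^ j * a * 2 ^ j             ≡⟨ regroup (s ^ j) a (2 ^ j) ⟩
    a * (2 ^ j * s ^ j)           ≡⟨ cong (a *_) (^-distribʳ-* 2 s j) ⟨
    a * (2 * s) ^ j               ≤⟨ *-monoʳ-≤ a (^≤!*^ (2 * s) j) ⟩
    a * (j ! * W)                 ≡⟨ *-assoc a (j !) W ⟨
    a * j ! * W                   ≤⟨ *-monoˡ-≤ W (P*!≤! K j j≤K) ⟩
    K ! * W                       ∎
    where
    open ≤-Reasoning
    a W : ℕ
    a = K P (K ∸ j)
    W = (2 * s) ^ (2 * s)
    regroup : ∀ x y z → x * y * z ≡ y * (z * x)
    regroup = solve-∀

  taylor-sum≤ : ∀ m L s → m ≤ s * s →
    taylorEven m L + s * taylorOdd m L ≤ 4 * ((2 * L + 1) ! * (2 * s) ^ (2 * s))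
  taylor-sum≤ m L s m≤s² = begin
    taylorEven m L + s * taylorOdd m L
      ≡⟨ cong₂ (λ e o → e + s * o) (sumᴸ-map-applyUpTo even (λ i → i) (suc L))
                                    (sumᴸ-map-applyUpTo odd (λ i → i) (suc L)) ⟩
    ∑[ i < suc L ] even (toℕ i) + s * ∑[ i < suc L ] odd (toℕ i)
      ≡⟨ cong (∑[ i < suc L ] even (toℕ i) +_) (*-distribˡ-sum s (odd ∘ toℕ {suc L})) ⟩
    ∑[ i < suc L ] even (toℕ i) + ∑[ i < suc L ] (s * odd (toℕ i))
      ≡⟨ ∑-distrib-+ (even ∘ toℕ {suc L}) (λ i → s * odd (toℕ i)) ⟨
    ∑[ i < suc L ] (even (toℕ i) + s * odd (toℕ i))
      ≡⟨ *-identityʳ _ ⟨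
    ∑[ i < suc L ] (even (toℕ i) + s * odd (toℕ i)) * 1
      ≤⟨ geometric {suc L} (λ i → even (toℕ i) + s * odd (toℕ i)) (2 * (K ! * W)) 1
                   (λ i → term≤ (toℕ i) (toℕ≤pred[n] i)) ⟩
    2 * (2 * (K ! * W))
      ≡⟨ 2*[2*x]≡4*x (K ! * W) ⟩
    4 * (K ! * W) ∎
    where
    open ≤-Reasoning
    K W : ℕ
    K = 2 * L + 1
    W = (2 * s) ^ (2 * s)
    even odd : ℕ → ℕ
    even i = m ^ i * (K P (K ∸ 2 * i))
    odd i = m ^ i * (K P (K ∸ (2 * i + 1)))
    2*[2*x]≡4*x : ∀ x → 2 * (2 * x) ≡ 4 * x
    2*[2*x]≡4*x = solve-∀
    m^i≤s^2i : ∀ i → m ^ i ≤ s ^ (2 * i)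
    m^i≤s^2i i = ≤-trans (^-monoˡ-≤ i m≤s²)
      (≤-reflexive (trans (cong (λ t → (s * t) ^ i) (sym (*-identityʳ s))) (^-*-assoc s 2 i)))
    term≤ : ∀ i → i ≤ L → (even i + s * odd i) * 2 ^ i * 1 ≤ 2 * (K ! * W)
    term≤ i i≤L = begin
      (even i + s * odd i) * 2 ^ i * 1                 ≡⟨ expand (even i) (s * odd i) (2 ^ i) ⟩
      even i * 2 ^ i + s * odd i * 2 ^ i               ≤⟨ +-mono-≤ even-term odd-term ⟩
      K ! * W + K ! * W                                ≡⟨ cong (K ! * W +_) (+-identityʳ (K ! * W)) ⟨
      2 * (K ! * W)                                    ∎
      where
      expand : ∀ a b c → (a + b) * c * 1 ≡ a * c + b * c
      expand = solve-∀
      2i≤2i+1 : 2 * i ≤ 2 * i + 1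
      2i≤2i+1 = m≤m+n (2 * i) 1
      2i+1≤K : 2 * i + 1 ≤ K
      2i+1≤K = +-monoˡ-≤ 1 (*-monoʳ-≤ 2 i≤L)
      even-term : even i * 2 ^ i ≤ K ! * W
      even-term = ≤-trans (*-mono-≤ (*-monoˡ-≤ (K P (K ∸ 2 * i)) (m^i≤s^2i i)) (^-monoʳ-≤ 2 (m≤n*m i 2)))
                          (taylor-term≤ K (2 * i) s (≤-trans 2i≤2i+1 2i+1≤K))
      odd-term : s * odd i * 2 ^ i ≤ K ! * W
      odd-term = ≤-trans (*-mono-≤ (≤-trans (≤-reflexive (sym (*-assoc s (m ^ i) _)))
                                            (*-monoˡ-≤ (K P (K ∸ (2 * i + 1))) s*m^i≤))
                                   (^-monoʳ-≤ 2 (≤-trans (m≤n*m i 2) 2i≤2i+1)))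
                         (taylor-term≤ K (2 * i + 1) s 2i+1≤K)
        where
        s*m^i≤ : s * m ^ i ≤ s ^ (2 * i + 1)
        s*m^i≤ = ≤-trans (*-monoʳ-≤ s (m^i≤s^2i i)) (≤-reflexive (cong (s ^_) (+-comm 1 (2 * i))))

  square-bracket : ∀ m → ∃ λ s → m ≤ s * s × s * s ≤ 4 * m
  square-bracket zero = 0 , z≤n , z≤n
  square-bracket (suc m) with square-bracket m
  ... | s , m≤s² , s²≤4m with suc m ≤? s * s
  ...   | yes m<s² = s , m<s² , ≤-trans s²≤4m (*-monoʳ-≤ 4 (n≤1+n m))
  ...   | no m≮s² =
    suc s , subst (suc m ≤_) (sym (square-suc s)) (s≤s (≤-trans m≤s² (m≤m+n (s * s) (2 * s)))) , (begin
    suc s * suc s                   ≡⟨ square-suc s ⟩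
    suc (s * s + 2 * s)             ≤⟨ s≤s (+-monoʳ-≤ (s * s) (*-monoʳ-≤ 2 (m≤m*m s))) ⟩
    suc (s * s + 2 * (s * s))       ≤⟨ m≤m+n _ (3 + s * s) ⟩
    suc (s * s + 2 * (s * s)) + (3 + s * s)   ≡⟨ regroup (s * s) ⟩
    4 * suc (s * s)                 ≤⟨ *-monoʳ-≤ 4 (s≤s s²≤m) ⟩
    4 * suc m                       ∎)
    where
    open ≤-Reasoning
    s²≤m : s * s ≤ m
    s²≤m = ≤-pred (≰⇒> m≮s²)
    square-suc : ∀ s → suc s * suc s ≡ suc (s * s + 2 * s)
    square-suc = solve-∀
    regroup : ∀ q → suc (q + 2 * q) + (3 + q) ≡ 4 * suc q
    regroup = solve-∀
    m≤m*m : ∀ s → s ≤ s * s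
    m≤m*m zero = z≤n
    m≤m*m (suc s) = m≤m*n (suc s) (suc s)

  log-sq-bound : ∀ {n m s} → LogSqLe n m → m ≤ s * s → n ≤ 4 * (2 * s) ^ (2 * s)
  log-sq-bound {n} {m} {s} (L , H) m≤s² = *-cancelʳ-≤ n (4 * W) (K !) {{K !≢0}} (begin
    n * K !                  ≤⟨ m≤n+m∸n (n * K !) Pe ⟩
    Pe + (n * K ! ∸ Pe)      ≤⟨ +-monoʳ-≤ Pe excess≤ ⟩
    Pe + s * Q               ≤⟨ taylor-sum≤ m L s m≤s² ⟩
    4 * (K ! * W)            ≡⟨ regroup (K !) W ⟩
    4 * W * K !              ∎)
    where
    open ≤-Reasoning
    K W Pe Q : ℕ
    K = 2 * L + 1
    W = (2 * s) ^ (2 * s)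
    Pe = taylorEven m L
    Q = taylorOdd m L
    regroup : ∀ k w → 4 * (k * w) ≡ 4 * w * k
    regroup = solve-∀
    excess≤ : n * K ! ∸ Pe ≤ s * Q
    excess≤ with n * K ! ∸ Pe ≤? s * Q
    ... | yes ≤ = ≤
    ... | no ≰ = ⊥-elim (<⇒≱ (≤-<-trans m*Q²≤[s*Q]² (^-monoˡ-< 2 (≰⇒> ≰))) H)
      where
      m*Q²≤[s*Q]² : m * Q ^ 2 ≤ (s * Q) ^ 2
      m*Q²≤[s*Q]² = ≤-trans (*-monoˡ-≤ (Q ^ 2) m≤s²) (≤-reflexive (square-* s Q))
        where
        square-* : ∀ a b → a * a * (b * (b * 1)) ≡ a * b * (a * b * 1)
        square-* = solve-∀

  2*s≤2^s : ∀ s → 2 * s ≤ 2 ^ s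
  2*s≤2^s zero = z≤n
  2*s≤2^s (suc zero) = ≤-refl
  2*s≤2^s (suc (suc s)) = begin
    2 * suc (suc s)            ≡⟨ unfold s ⟩
    2 * suc s + 2              ≤⟨ +-mono-≤ (2*s≤2^s (suc s)) (^-monoʳ-≤ 2 {1} {suc s} (s≤s z≤n)) ⟩
    2 ^ suc s + 2 ^ suc s      ≡⟨ cong (2 ^ suc s +_) (+-identityʳ (2 ^ suc s)) ⟨
    2 ^ suc (suc s)            ∎
    where
    open ≤-Reasoning
    unfold : ∀ s → 2 * suc (suc s) ≡ 2 * suc s + 2
    unfold = solve-∀

  log-bound : ∀ {n m} → 5 ≤ n → LogSqLe n m → 1 ≤ m × n ≤ 2 ^ (10 * m)
  log-bound {n} {m} 5≤n log =
    let s , m≤s² , s²≤4m = square-bracket m in from-square m s s²≤4m (log-sq-bound {s = s} log m≤s²)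
    where
    from-square : ∀ m s → s * s ≤ 4 * m → n ≤ 4 * (2 * s) ^ (2 * s) → 1 ≤ m × n ≤ 2 ^ (10 * m)
    from-square zero zero _ n≤4 = ⊥-elim (<⇒≱ 5≤n n≤4)
    from-square zero (suc s) () _
    from-square (suc k) s s²≤4m n≤4W = s≤s z≤n , (begin
      n                                ≤⟨ n≤4W ⟩
      4 * (2 * s) ^ (2 * s)            ≤⟨ *-monoʳ-≤ 4 (^-monoˡ-≤ (2 * s) (2*s≤2^s s)) ⟩
      4 * (2 ^ s) ^ (2 * s)            ≡⟨ cong (4 *_) (^-*-assoc 2 s (2 * s)) ⟩
      2 ^ 2 * 2 ^ (s * (2 * s))        ≡⟨ ^-distribˡ-+-* 2 2 (s * (2 * s)) ⟨
      2 ^ (2 + s * (2 * s))            ≤⟨ ^-monoʳ-≤ 2 exponent≤ ⟩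
      2 ^ (10 * suc k)                 ∎)
      where
      open ≤-Reasoning
      exponent≤ : 2 + s * (2 * s) ≤ 10 * suc k
      exponent≤ = begin
        2 + s * (2 * s)                ≡⟨ cong (2 +_) (twice-square s) ⟩
        2 + 2 * (s * s)                ≤⟨ +-monoʳ-≤ 2 (*-monoʳ-≤ 2 s²≤4m) ⟩
        2 + 2 * (4 * suc k)            ≡⟨ expand k ⟩
        10 + 8 * k                     ≤⟨ +-monoʳ-≤ 10 (*-monoˡ-≤ k (m≤m+n 8 2)) ⟩
        10 + 10 * k                    ≡⟨ *-suc 10 k ⟨
        10 * suc k                     ∎
        where
        twice-square : ∀ s → s * (2 * s) ≡ 2 * (s * s)
        twice-square = solve-∀
        expand : ∀ k → 2 + 2 * (4 * suc k) ≡ 10 + 8 * k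
        expand = solve-∀

module Rationals where
  open import Data.Nat as ℕ using (ℕ; suc; _≤_; _<_; z≤n; s≤s)
  import Data.Nat.Properties as ℕ
  open import Data.Nat.Tactic.RingSolver using (solve-∀)
  open import Data.Integer as ℤ using (+_; +[1+_])
  import Data.Integer.Properties as ℤ
  open import Data.Rational using (mkℚ; _/_; _+_; _*_; ½; 0ℚ; toℚᵘ; positive; Positive)
    renaming (_≤_ to _≤ℚ_; _<_ to _<ℚ_)
  open import Data.Rational.Properties
    using (toℚᵘ-mono-≤; toℚᵘ-mono-<; toℚᵘ-homo-+; toℚᵘ-homo-*; toℚᵘ-fromℚᵘ; <-trans)
  open import Data.Rational.Unnormalised as ᵘ using (mkℚᵘ; _≃_; *≤*; *<*)
  import Data.Rational.Unnormalised.Properties as ᵘ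
  open import Data.Product using (Σ; _×_; _,_)
  open import Relation.Binary.PropositionalEquality using (_≡_; refl; sym; trans; cong; cong₂; subst₂)

  ℕ/1≃ : ∀ n → toℚᵘ (+ n / 1) ≃ mkℚᵘ (+ n) 0
  ℕ/1≃ n = toℚᵘ-fromℚᵘ (mkℚᵘ (+ n) 0)

  ½≃ : toℚᵘ ½ ≃ mkℚᵘ (+ 1) 1
  ½≃ = toℚᵘ-fromℚᵘ (mkℚᵘ (+ 1) 1)

  cross-≤ : ∀ {i j b d a c} → i ≡ + a → j ≡ + c → mkℚᵘ i b ᵘ.≤ mkℚᵘ j d → a ℕ.* suc d ≤ c ℕ.* suc b
  cross-≤ {b = b} {d} {a} {c} refl refl (*≤* ad≤cb) =
    ℤ.drop‿+≤+ (subst₂ ℤ._≤_ (sym (ℤ.pos-* a (suc d))) (sym (ℤ.pos-* c (suc b))) ad≤cb)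

  cross-< : ∀ {i j b d a c} → i ≡ + a → j ≡ + c → mkℚᵘ i b ᵘ.< mkℚᵘ j d → a ℕ.* suc d < c ℕ.* suc b
  cross-< {b = b} {d} {a} {c} refl refl (*<* ad<cb) =
    ℤ.drop‿+<+ (subst₂ ℤ._<_ (sym (ℤ.pos-* a (suc d))) (sym (ℤ.pos-* c (suc b))) ad<cb)

  min-degree-bound : ∀ ε → 0ℚ <ℚ ε → Σ ℕ λ R → 2 ≤ R ×
    ∀ n d → (½ + ε) * (+ n / 1) ≤ℚ + d / 1 → (R ℕ.+ 2) ℕ.* n ≤ 2 ℕ.* R ℕ.* d
  min-degree-bound ε 0<ε = from-positive ε (positive 0<ε)
    where
    -- ε ≥ 1 / suc r; doubling the denominator also makes R ≥ 2.
    from-positive : ∀ ε → Positive ε → Σ ℕ λ R → 2 ≤ R ×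
      ∀ n d → (½ + ε) * (+ n / 1) ≤ℚ + d / 1 → (R ℕ.+ 2) ℕ.* n ≤ 2 ℕ.* R ℕ.* d
    from-positive ε@(mkℚ +[1+ p ] r _) _ = 2 ℕ.* suc r , ℕ.*-monoʳ-≤ 2 (s≤s z≤n) , degree-bound
      where
      unnormalise : ∀ n → toℚᵘ ((½ + ε) * (+ n / 1)) ≃ (mkℚᵘ (+ 1) 1 ᵘ.+ mkℚᵘ +[1+ p ] r) ᵘ.* mkℚᵘ (+ n) 0
      unnormalise n = ᵘ.≃-trans (toℚᵘ-homo-* (½ + ε) (+ n / 1))
        (ᵘ.*-cong (ᵘ.≃-trans (toℚᵘ-homo-+ ½ ε) (ᵘ.+-cong {toℚᵘ ½} {_} {toℚᵘ ε} {toℚᵘ ε} ½≃ (ᵘ.≃-refl {toℚᵘ ε})))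
                  (ℕ/1≃ n))
      numerator : ∀ n → (+ 1 ℤ.* + suc r ℤ.+ + suc p ℤ.* + 2) ℤ.* + n ≡ + ((1 ℕ.* suc r ℕ.+ suc p ℕ.* 2) ℕ.* n)
      numerator n = sym (trans (ℤ.pos-* (1 ℕ.* suc r ℕ.+ suc p ℕ.* 2) n)
        (cong (ℤ._* + n) (trans (ℤ.pos-+ (1 ℕ.* suc r) (suc p ℕ.* 2))
                                (cong₂ ℤ._+_ (ℤ.pos-* 1 (suc r)) (ℤ.pos-* (suc p) 2)))))
      expand : ∀ r p n →
        (2 ℕ.* suc r ℕ.+ 2) ℕ.* n ℕ.+ (4 ℕ.* p ℕ.+ 2) ℕ.* n ≡ 2 ℕ.* ((1 ℕ.* suc r ℕ.+ suc p ℕ.* 2) ℕ.* n ℕ.* 1)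
      expand = solve-∀
      regroup : ∀ d r → 2 ℕ.* (d ℕ.* (2 ℕ.* suc r ℕ.* 1)) ≡ 2 ℕ.* (2 ℕ.* suc r) ℕ.* d
      regroup = solve-∀
      degree-bound : ∀ n d → (½ + ε) * (+ n / 1) ≤ℚ + d / 1 →
        (2 ℕ.* suc r ℕ.+ 2) ℕ.* n ≤ 2 ℕ.* (2 ℕ.* suc r) ℕ.* d
      degree-bound n d δ≤d = begin
        (2 ℕ.* suc r ℕ.+ 2) ℕ.* n                               ≤⟨ ℕ.m≤m+n _ ((4 ℕ.* p ℕ.+ 2) ℕ.* n) ⟩
        (2 ℕ.* suc r ℕ.+ 2) ℕ.* n ℕ.+ (4 ℕ.* p ℕ.+ 2) ℕ.* n     ≡⟨ expand r p n ⟩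
        2 ℕ.* (a ℕ.* 1)                                          ≤⟨ ℕ.*-monoʳ-≤ 2 a≤d ⟩
        2 ℕ.* (d ℕ.* (2 ℕ.* suc r ℕ.* 1))                        ≡⟨ regroup d r ⟩
        2 ℕ.* (2 ℕ.* suc r) ℕ.* d                                ∎
        where
        open ℕ.≤-Reasoning
        a : ℕ
        a = (1 ℕ.* suc r ℕ.+ suc p ℕ.* 2) ℕ.* n
        a≤d : a ℕ.* 1 ≤ d ℕ.* (2 ℕ.* suc r ℕ.* 1)
        a≤d = cross-≤ (numerator n) refl
                (ᵘ.≤-respʳ-≃ (ℕ/1≃ d) (ᵘ.≤-respˡ-≃ (unnormalise n) (toℚᵘ-mono-≤ δ≤d)))

  small-set : ∀ ε c → 0ℚ <ℚ c → (+ 1024 / 1) * c <ℚ ε → ε <ℚ ½ → ∀ u m → + u / 1 ≤ℚ c * (+ m / 1) → u ≤ m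
  -- The hypotheses give c < 1 / 2048, far more than the c ≤ 1 used here.
  small-set ε c 0<c 1024c<ε ε<½ = from-positive c (positive 0<c) (<-trans 1024c<ε ε<½)
    where
    from-positive : ∀ c → Positive c → (+ 1024 / 1) * c <ℚ ½ → ∀ u m → + u / 1 ≤ℚ c * (+ m / 1) → u ≤ m
    from-positive c@(mkℚ +[1+ a ] b _) _ 1024c<½ u m u≤cm = ℕ.*-cancelʳ-≤ u m (suc b) (begin
      u ℕ.* suc b              ≡⟨ cong (u ℕ.*_) (ℕ.*-identityʳ (suc b)) ⟨
      u ℕ.* (suc b ℕ.* 1)      ≤⟨ u*b≤a*m ⟩
      suc a ℕ.* m ℕ.* 1        ≡⟨ ℕ.*-identityʳ (suc a ℕ.* m) ⟩
      suc a ℕ.* m              ≤⟨ ℕ.*-monoˡ-≤ m a≤b ⟩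
      suc b ℕ.* m              ≡⟨ ℕ.*-comm (suc b) m ⟩
      m ℕ.* suc b              ∎)
      where
      open ℕ.≤-Reasoning
      1024a<b : 1024 ℕ.* suc a ℕ.* 2 < 1 ℕ.* suc (b ℕ.+ 0)
      1024a<b = cross-< (sym (ℤ.pos-* 1024 (suc a))) refl
        (ᵘ.<-respʳ-≃ ½≃ (ᵘ.<-respˡ-≃ unnormalise (toℚᵘ-mono-< 1024c<½)))
        where
        unnormalise : toℚᵘ ((+ 1024 / 1) * c) ≃ mkℚᵘ (+ 1024) 0 ᵘ.* mkℚᵘ +[1+ a ] b
        unnormalise = ᵘ.≃-trans (toℚᵘ-homo-* (+ 1024 / 1) c)
          (ᵘ.*-cong {toℚᵘ (+ 1024 / 1)} {_} {toℚᵘ c} {toℚᵘ c} (ℕ/1≃ 1024) (ᵘ.≃-refl {toℚᵘ c}))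
      a≤b : suc a ≤ suc b
      a≤b = ℕ.≤-trans (ℕ.m≤n*m (suc a) 1024) (ℕ.≤-trans (ℕ.m≤m*n (1024 ℕ.* suc a) 2)
              (ℕ.≤-trans (ℕ.<⇒≤ 1024a<b) (ℕ.≤-reflexive (trans (ℕ.*-identityˡ _) (cong suc (ℕ.+-identityʳ b))))))
      u*b≤a*m : u ℕ.* (suc b ℕ.* 1) ≤ suc a ℕ.* m ℕ.* 1
      u*b≤a*m = cross-≤ refl (sym (ℤ.pos-* (suc a) m))
        (ᵘ.≤-respˡ-≃ (ℕ/1≃ u) (ᵘ.≤-respʳ-≃ unnormalise (toℚᵘ-mono-≤ u≤cm)))
        where
        unnormalise : toℚᵘ (c * (+ m / 1)) ≃ mkℚᵘ +[1+ a ] b ᵘ.* mkℚᵘ (+ m) 0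
        unnormalise = ᵘ.≃-trans (toℚᵘ-homo-* c (+ m / 1))
          (ᵘ.*-cong {toℚᵘ c} {toℚᵘ c} {toℚᵘ (+ m / 1)} {_} (ᵘ.≃-refl {toℚᵘ c}) (ℕ/1≃ m))

module Subsets where
  open import Data.Nat using (suc)
  open import Data.Bool using (true; false)
  open import Data.Fin using (Fin; zero; suc)
  open import Data.Fin.Properties using (suc-injective)
  open import Data.Fin.Subset using (Subset; ∣_∣) renaming (_∈_ to _∈ₛ_)
  open import Data.Vec using ([]; _∷_; here; there)
  open import Data.List using (List; []; _∷_; map; length)
  open import Data.List.Properties using (length-map)
  open import Data.List.Membership.Propositional using (_∈_; _∉_)
  open import Data.List.Membership.Propositional.Properties using (∈-map⁺; ∈-map⁻)
  open import Data.List.Relation.Unary.Any using (here; there)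
  open import Data.List.Relation.Unary.Unique.Propositional using (Unique)
  open import Data.List.Relation.Unary.AllPairs using ([])
  import Data.List.Relation.Unary.Unique.Propositional.Properties as Unique
  open import Data.Product using (_,_)
  open import Relation.Binary.PropositionalEquality using (_≡_; refl; trans; cong)
  open Absorbers using (unique-∷)

  elements : ∀ {n} → Subset n → List (Fin n)
  elements [] = []
  elements (true ∷ p) = zero ∷ map suc (elements p)
  elements (false ∷ p) = map suc (elements p)

  length-elements : ∀ {n} (p : Subset n) → length (elements p) ≡ ∣ p ∣
  length-elements [] = refl
  length-elements (true ∷ p) = cong suc (trans (length-map suc (elements p)) (length-elements p))
  length-elements (false ∷ p) = trans (length-map suc (elements p)) (length-elements p)

  ∈-elements⁻ : ∀ {n} (p : Subset n) {x} → x ∈ elements p → x ∈ₛ p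
  ∈-elements⁻ (true ∷ p) (here refl) = here
  ∈-elements⁻ (true ∷ p) (there x∈) with ∈-map⁻ suc x∈
  ... | y , y∈ , refl = there (∈-elements⁻ p y∈)
  ∈-elements⁻ (false ∷ p) x∈ with ∈-map⁻ suc x∈
  ... | y , y∈ , refl = there (∈-elements⁻ p y∈)

  ∈-elements⁺ : ∀ {n} (p : Subset n) {x} → x ∈ₛ p → x ∈ elements p
  ∈-elements⁺ (true ∷ p) here = here refl
  ∈-elements⁺ (true ∷ p) (there x∈) = there (∈-map⁺ suc (∈-elements⁺ p x∈))
  ∈-elements⁺ (false ∷ p) (there x∈) = ∈-map⁺ suc (∈-elements⁺ p x∈)

  elements-unique : ∀ {n} (p : Subset n) → Unique (elements p)
  elements-unique [] = []
  elements-unique (true ∷ p) = unique-∷ zero∉ (Unique.map⁺ suc-injective (elements-unique p))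
    where
    zero∉ : zero ∉ map suc (elements p)
    zero∉ z∈ with ∈-map⁻ suc z∈
    ... | _ , _ , ()
  elements-unique (false ∷ p) = Unique.map⁺ suc-injective (elements-unique p)

open import Data.Nat using (ℕ) renaming (_≤_ to _≤ℕ_; _*_ to _*ℕ_)
open import Data.Integer using (+_)
open import Data.Rational using (ℚ; _/_; _+_; _*_; _≤_; _<_; ½; 0ℚ)
open import Data.Fin using (Fin)
open import Data.Fin.Subset using (Subset; ∣_∣) renaming (_∈_ to _∈ₛ_; _∉_ to _∉ₛ_)
open import Data.List using (List; length)
open import Data.List.Membership.Propositional using (_∈_)
open import Data.Product using (Σ; ∃; _×_)
open import Data.Sum using (_⊎_)
open import Function.Bundles using (_⇔_)
open import Relation.Nullary using (¬_)

open import Data.Nat using (z≤n; s≤s) renaming (_+_ to _+ℕ_)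
open import Data.Nat.Properties using (≤-trans)
open import Data.Product using (_,_)
import Data.Sum as Sum
open import Function using (_∘_)
open import Function.Bundles using (mk⇔; Equivalence)
open import Relation.Binary.PropositionalEquality using (subst; sym)
import Data.List.Relation.Unary.All as All
open Logarithm using (log-bound)
open Rationals using (min-degree-bound; small-set)
open AbsorbingPath using (absorbing-path)
open Subsets using (elements; length-elements; ∈-elements⁺; ∈-elements⁻; elements-unique)

lemma3p1 : (ε c : ℚ) → 0ℚ < ε → ε < ½ → 0ℚ < c → (+ 1024 / 1) * c < ε →
    Σ ℕ λ C → Σ ℕ λ n₀ →
      ∀ (n m : ℕ) → n₀ ≤ℕ n → LogSqLe n m → C *ℕ m ≤ℕ n →
      (G : Graph n) → (∀ v → (½ + ε) * (+ n / 1) ≤ + deg G v / 1) →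
      Σ (List (Fin n)) λ A → IsPath G A × length A ≤ℕ C *ℕ m ×
        (∀ (U : Subset n) → (∀ x → x ∈ₛ U → ¬ (x ∈ A)) → + ∣ U ∣ / 1 ≤ c * (+ m / 1) →
          Σ (List (Fin n)) λ AU → IsPath G AU × SameEndpoints AU A ×
            (∀ x → (x ∈ AU) ⇔ ((x ∈ A) ⊎ (x ∈ₛ U))))
lemma3p1 ε c 0<ε ε<½ 0<c 1024c<ε =
  let R , 2≤R , degree-bound = min-degree-bound ε 0<ε
  in R *ℕ (36 *ℕ (2 *ℕ R *ℕ R) +ℕ 2) , 5 , λ n m 5≤n log Cm≤n G δ≥ →
    let 1≤m , n≤2^10m = log-bound 5≤n log
        dense = record { min-degree = λ v → degree-bound n (deg G v) (δ≥ v) }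
        A , path , length≤ , absorb = absorbing-path G 2≤R dense (≤-trans (s≤s z≤n) 5≤n) 1≤m n≤2^10m Cm≤n
    in A , path , length≤ , λ U U∉A |U|≤cm →
      let |U|≤m = subst (_≤ℕ m) (sym (length-elements U)) (small-set ε c 0<c 1024c<ε ε<½ ∣ U ∣ m |U|≤cm)
          AU , pathU , ends , members = absorb (elements U) (elements-unique U)
                                          (All.tabulate (λ x∈U → U∉A _ (∈-elements⁻ U x∈U))) |U|≤m
      in AU , pathU , ends , λ x → mk⇔ (Sum.map₂ (∈-elements⁻ U) ∘ Equivalence.to (members x))
                                       (Equivalence.from (members x) ∘ Sum.map₂ (∈-elements⁺ U))
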